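{- $\mathit{Leaf}(\mathbb{T}^S_{!(T1,T2)}(G))=\Pi^!_{\mathit{mcp}}(G)$.
   Context: Let $G=(V,E)$ be a finite undirected graph. A clique is a nonempty set of pairwise adjacent vertices; it is maximal if not properly contained in another clique. A clique-partition of $G$ is a partition of $V$ into cliques; it is maximal if it does not contain two different cliques $C,C'$ with $C\cup C'$ a clique. Fix an enumeration $\overline{C}_1,\ldots,\overline{C}_m$ of all maximal cliques of $G$. For $v\in V$ let $\mathit{cliques}(v):=\{i\in[m]\mid v\in\overline{C}_i\}$, $d(v):=|\mathit{cliques}(v)|$, and for nonempty $C\subseteq V$ let $\mathit{cliques}(C):=\bigcap_{v\in C}\mathit{cliques}(v)$. Let $\mathit{Rgd}:=\{k\in[m]\mid \exists v\in V,\ \mathit{cliques}(v)=\{k\}\}$. Fix an enumeration $S=[v_1,\ldots,v_s]$ of all vertices $v$ with $d(v)>1$. A configuration is a list $[C_1,\ldots,C_m]$ where each $C_i$ is empty or a clique, $C_i\subseteq\overline{C}_i$, and $\bigcup_i C_i=V$; $\mathit{repr}([C_1,\ldots,C_m]):=\{C_i\mid C_i\neq\emptyset\}$. $\Pi_{\mathit{mcp}}(G)$ is the set of configurations whose $\mathit{repr}$ is a maximal clique-partition; $\Pi^!_{\mathit{mcp}}(G)$ is the set of $[C_1,\ldots,C_m]\in\Pi_{\mathit{mcp}}(G)$ such that for all $1\le j<i\le m$, if $C_j\neq\emptyset$ then $i\notin\mathit{cliques}(C_j)$. Write $[C_1,\ldots,C_m]\to_{(v,i)}[C'_1,\ldots,C'_m]$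 if $v\in C_i$, $C'_i=C_i$ and $C'_j=C_j\setminus\{v\}$ for $j\neq i$. The search tree $\mathbb{T}^S(G)$ has root $[\overline{C}_1,\ldots,\overline{C}_m]$ at depth $0$; a node at depth $k<s$ carrying $\mathit{cfg}$ has, for each $i\in\mathit{cliques}(v_{k+1})$, a child at depth $k+1$ carrying $\mathit{cfg}'$ with $\mathit{cfg}\to_{(v_{k+1},i)}\mathit{cfg}'$. For a node reached by $\mathit{cfg}_0\to_{(v_1,i_1)}\cdots\to_{(v_\ell,i_\ell)}\mathit{cfg}$ set $\delta(\mathit{cfg}):=[i_1,\ldots,i_\ell]$. A node $\mathit{cfg}=[C_1,\ldots,C_m]$ with $\delta(\mathit{cfg})=[i_1,\ldots,i_\ell]$ is a $T1$-node if either (a) $\mathit{cliques}(C_a)\cap\mathit{Rgd}\neq\emptyset$ for some $a\in\{i_1,\ldots,i_\ell\}\setminus\mathit{Rgd}$, or (b) $\mathit{cliques}(C_a)\cap\mathit{cliques}(C_b)\neq\emptyset$ for distinct $a,b\in\{i_1,\ldots,i_\ell\}$. $\mathbb{T}^S_{!(T1)}(G)$ is obtained from $\mathbb{T}^S(G)$ by removing every subtree whose root is a $T1$-node. A node $\mathit{cfg}=[C_1,\ldots,C_m]$ of $\mathbb{T}^S_{!(T1)}(G)$ with $\delta(\mathit{cfg})=[i_1,\ldots,i_\ell]$ is a $T2$-node if there exist $1\le j<i\le m$ with $j\in\{i_1,\ldots,i_\ell\}\setminus\mathit{Rgd}$ and $i\in\mathit{cliques}(C_j)$. $\mathbb{T}^S_{!(T1,T2)}(G)$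 is obtained from $\mathbb{T}^S_{!(T1)}(G)$ by removing every subtree whose root is a $T2$-node, and $\mathit{Leaf}(\mathbb{T}^S_{!(T1,T2)}(G))$ is the set of configurations at depth $s$ in $\mathbb{T}^S_{!(T1,T2)}(G)$. -}

module Defs where

open import Data.Nat as ℕ using (ℕ; zero; suc; _<_)
open import Data.Fin as Fin using (Fin; fromℕ<)
open import Data.Fin.Subset
open import Data.Fin.Subset.Properties using (_∈?_)
open import Data.Vec using (Vec; lookup; tabulate)
open import Data.List using (List; []; _∷_; _++_; [_])
open import Data.List.Membership.Propositional renaming (_∈_ to _∈ₗ_)
open import Data.Product using (Σ; ∃; ∃-syntax; _×_; _,_)
open import Data.Sum using (_⊎_)
open import Relation.Nullary using (¬_; Dec; does)
open import Relation.Binary.PropositionalEquality using (_≡_; _≢_)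
open import Function.Definitions using (Injective)

record Graph : Set₁ where
  field
    n    : ℕ
    E    : Fin n → Fin n → Set
    sym  : ∀ {u v} → E u v → E v u
    irr  : ∀ {v} → ¬ E v v
    dec  : ∀ u v → Dec (E u v)

module _ (G : Graph) where
  open Graph G

  V : Set
  V = Fin n

  IsClique : Subset n → Set
  IsClique C = Nonempty C × (∀ u v → u ∈ C → v ∈ C → u ≢ v → E u v)

  IsMaximalClique : Subset n → Set
  IsMaximalClique C = IsClique C × (∀ D → IsClique D → C ⊆ D → D ⊆ C)

  Family : Set₁
  Family = Subset n → Set

  IsCliquePartition : Family → Set
  IsCliquePartition P =
      (∀ C → P C → IsClique C)
    × (∀ C C' → P C → P C' → C ≢ C' → Empty (C ∩ C'))
    × (∀ v → ∃[ C ] (P C × v ∈ C))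

  IsMaxCliquePartition : Family → Set
  IsMaxCliquePartition P =
    IsCliquePartition P × (∀ C C' → P C → P C' → C ≢ C' → ¬ IsClique (C ∪ C'))

  record MaxCliqueEnum : Set where
    field
      m        : ℕ
      Cl       : Fin m → Subset n
      injCl    : Injective _≡_ _≡_ Cl
      maxCl    : ∀ i → IsMaximalClique (Cl i)
      complete : ∀ C → IsMaximalClique C → ∃[ i ] Cl i ≡ C

  module _ (ME : MaxCliqueEnum) where
    open MaxCliqueEnum ME

    cliquesV : V → Subset m
    cliquesV v = tabulate (λ i → does (v ∈? Cl i))

    d : V → ℕ
    d v = ∣ cliquesV v ∣

    -- i ∈ cliques(C) = ⋂_{v ∈ C} cliques(v)  (used only for nonempty C)
    _∈cliques_ : Fin m → Subset n → Set
    i ∈cliques C = ∀ v → v ∈ C → i ∈ cliquesV v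

    Rgd : Fin m → Set
    Rgd k = ∃[ v ] cliquesV v ≡ ⁅ k ⁆

    Config : Set
    Config = Vec (Subset n) m

    IsConfig : Config → Set
    IsConfig cfg =
        (∀ i → Empty (lookup cfg i) ⊎ IsClique (lookup cfg i))
      × (∀ i → lookup cfg i ⊆ Cl i)
      × (∀ v → ∃[ i ] v ∈ lookup cfg i)

    repr : Config → Family
    repr cfg C = ∃[ i ] (lookup cfg i ≡ C × Nonempty C)

    Πmcp : Config → Set
    Πmcp cfg = IsConfig cfg × IsMaxCliquePartition (repr cfg)

    Π! : Config → Set
    Π! cfg = Πmcp cfg ×
      (∀ j i → j Fin.< i → Nonempty (lookup cfg j) → ¬ (i ∈cliques (lookup cfg j)))

    Move : Config → V → Fin m → Config → Set
    Move cfg v i cfg' =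
        v ∈ lookup cfg i
      × lookup cfg' i ≡ lookup cfg i
      × (∀ j → j ≢ i → lookup cfg' j ≡ lookup cfg j - v)

    root : Config
    root = tabulate Cl

    -- T1-nodes, in terms of δ(cfg) = [i_1,…,i_ℓ] and cfg
    T1 : List (Fin m) → Config → Set
    T1 δ cfg =
        (∃[ a ] (a ∈ₗ δ × ¬ Rgd a × ∃[ k ] (k ∈cliques (lookup cfg a) × Rgd k)))
      ⊎ (∃[ a ] ∃[ b ] (a ∈ₗ δ × b ∈ₗ δ × a ≢ b
           × ∃[ k ] (k ∈cliques (lookup cfg a) × k ∈cliques (lookup cfg b))))

    T2 : List (Fin m) → Config → Set
    T2 δ cfg = ∃[ j ] ∃[ i ] (j Fin.< i × j ∈ₗ δ × ¬ Rgd j × i ∈cliques (lookup cfg j))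

    record MultiEnum : Set where
      field
        s        : ℕ
        vs       : Fin s → V
        injvs    : Injective _≡_ _≡_ vs
        multi    : ∀ k → 1 < d (vs k)
        complete : ∀ v → 1 < d v → ∃[ k ] vs k ≡ v

    module _ (SE : MultiEnum) where
      open MultiEnum SE

      -- Nodes of the search tree T^S(G) from which every subtree rooted at a
      -- node satisfying Prune has been removed:  Node Prune ℓ δ cfg  says that
      -- there is a node at depth ℓ carrying cfg with δ(cfg) = δ.
      data Node (Prune : List (Fin m) → Config → Set)
           : ℕ → List (Fin m) → Config → Set where
        nroot  : ¬ Prune [] root → Node Prune 0 [] root
        nchild : ∀ {k δ cfg cfg'} (k<s : k < s) (i : Fin m) →
                 Node Prune k δ cfg →
                 i ∈ cliquesV (vs (fromℕ< k<s)) →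
                 Move cfg (vs (fromℕ< k<s)) i cfg' →
                 ¬ Prune (δ ++ [ i ]) cfg' →
                 Node Prune (suc k) (δ ++ [ i ]) cfg'

      -- T^S_{!(T1,T2)}(G): remove T1-subtrees, then T2-subtrees of what remains
      T1orT2 : List (Fin m) → Config → Set
      T1orT2 δ cfg = T1 δ cfg ⊎ T2 δ cfg

      Leaf : Config → Set
      Leaf cfg = ∃[ δ ] Node T1orT2 s δ cfg

{-# OPTIONS --safe #-}
-- Both sides coincide with the canonical configurations: every cell lies in its own maximal
-- clique, every vertex lies in exactly one cell, no two nonempty cells fit into a common maximal
-- clique, and no nonempty cell Cⱼ lies in a later C̄ᵢ.  Along a path of the tree the unprocessed
-- vertices stay everywhere and each processed vertex keeps only the cell chosen for it, so at a
-- leaf every nonempty cell is either chosen (its index occurs in δ) or contains a vertex lying in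
-- no other maximal clique; the absence of T1-nodes then makes the cells unmergeable and the
-- absence of T2-nodes makes them ordered.  Conversely, for a canonical c the path sending each vᵢ
-- to its cell in c only meets configurations that are cellwise above c; T1 and T2 are antitone
-- in the cells, so no node of that path is pruned, and it ends in c.
module Submission where

open import Defs
open import Data.Nat as ℕ using (ℕ; zero; suc; _≤_; _<_; s≤s)
import Data.Nat.Properties as ℕ
open import Data.Fin as Fin using (Fin; toℕ; fromℕ<)
import Data.Fin.Properties as Fin
open import Data.Fin.Subset hiding (⊥)
open import Data.Fin.Subset.Properties
open import Data.Vec using (Vec; _∷_; there; lookup; tabulate; map; _[_]≔_)
open import Data.Vec.Properties
  using ([]=⇒lookup; lookup⇒[]=; lookup∘tabulate; tabulate∘lookup; tabulate-cong; lookup∘update; lookup∘update′; lookup-map)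
open import Data.List using (List; []; _∷_; _++_; [_]; allFin)
open import Data.List.Membership.Propositional using () renaming (_∈_ to _∈ₗ_)
import Data.List.Relation.Unary.Any as List
open import Data.List.Membership.Propositional.Properties using (∈-allFin; ∈-++⁻; ∈-++⁺ˡ; ∈-++⁺ʳ)
open import Data.Product using (∃-syntax; _×_; _,_; proj₁; proj₂)
open import Data.Sum using (_⊎_; inj₁; inj₂; [_,_]′)
open import Data.Empty using (⊥)
open import Data.Bool using (true)
open import Function using (_∘_)
open import Function.Bundles using (_⇔_; mk⇔; Equivalence)
open import Relation.Unary using (Pred; Decidable)
open import Relation.Binary.Definitions using (tri<; tri≈; tri>)
open import Relation.Nullary using (¬_; Dec; yes; no; does; contradiction)
open import Relation.Nullary.Decidable using (_→-dec_; ¬?; dec-true)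
open import Relation.Binary.PropositionalEquality using (_≡_; _≢_; refl; sym; trans; cong; subst)

x∈p─q⇒x∉q : ∀ {n} {x : Fin n} (p q : Subset n) → x ∈ p ─ q → x ∉ q
x∈p─q⇒x∉q (_ ∷ p) (_ ∷ q) (there x∈p─q) (there x∈q) = x∈p─q⇒x∉q p q x∈p─q x∈q

x∈p-y⇒x∈p : ∀ {n} {x y : Fin n} (p : Subset n) → x ∈ p - y → x ∈ p
x∈p-y⇒x∈p {y = y} p = p─q⊆p p ⁅ y ⁆

x∈p-y⇒x≢y : ∀ {n} {x y : Fin n} (p : Subset n) → x ∈ p - y → x ≢ y
x∈p-y⇒x≢y {y = y} p x∈ refl = x∈p─q⇒x∉q p ⁅ y ⁆ x∈ (x∈⁅x⁆ y)

∪-least : ∀ {n} {p q r : Subset n} → p ⊆ r → q ⊆ r → p ∪ q ⊆ r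
∪-least {p = p} {q} p⊆r q⊆r x∈ = [ p⊆r , q⊆r ]′ (x∈p∪q⁻ p q x∈)

∣p∣≤1⇒x≡y : ∀ {n} {p : Subset n} {x y} → ∣ p ∣ ≤ 1 → x ∈ p → y ∈ p → x ≡ y
∣p∣≤1⇒x≡y {p = p} {x} {y} ∣p∣≤1 x∈p y∈p with x Fin.≟ y
... | yes x≡y = x≡y
... | no x≢y = contradiction ∣p∣≤1 (ℕ.<⇒≱ 1<∣p∣)
  where
  open ℕ.≤-Reasoning
  ⁅y⁆⊆p-x : ⁅ y ⁆ ⊆ p - x
  ⁅y⁆⊆p-x z∈ rewrite x∈⁅y⁆⇒x≡y y z∈ = x∈p∧x≢y⇒x∈p-y y∈p (x≢y ∘ sym)
  1<∣p∣ : 1 < ∣ p ∣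
  1<∣p∣ = begin-strict
    1          ≡⟨ ∣⁅x⁆∣≡1 y ⟨
    ∣ ⁅ y ⁆ ∣  ≤⟨ p⊆q⇒∣p∣≤∣q∣ ⁅y⁆⊆p-x ⟩
    ∣ p - x ∣  <⟨ x∈p⇒∣p-x∣<∣p∣ x∈p ⟩
    ∣ p ∣      ∎

x∈tabulate⇔ : ∀ {n p} {P : Pred (Fin n) p} (P? : Decidable P) {x} →
              x ∈ tabulate (does ∘ P?) ⇔ P x
x∈tabulate⇔ {P = P} P? {x} = mk⇔
  (λ x∈ → witness (P? x) (trans (sym (lookup∘tabulate (does ∘ P?) x)) ([]=⇒lookup x∈)))
  (λ px → lookup⇒[]= x _ (trans (lookup∘tabulate (does ∘ P?) x) (dec-true (P? x) px)))
  where
  witness : (d : Dec (P x)) → does d ≡ true → P x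
  witness (yes px) _ = px

lookup-ext : ∀ {a} {A : Set a} {n} {xs ys : Vec A n} → (∀ i → lookup xs i ≡ lookup ys i) → xs ≡ ys
lookup-ext {xs = xs} {ys} eq =
  trans (sym (tabulate∘lookup xs)) (trans (tabulate-cong eq) (tabulate∘lookup ys))

module _ (G : Graph) where
  open Graph G renaming (sym to E-sym)

  AdjacentToAll : Fin n → Subset n → Set
  AdjacentToAll u X = ∀ w → w ∈ X → w ≢ u → E u w

  adjacentToAll? : ∀ u X → Dec (AdjacentToAll u X)
  adjacentToAll? u X = Fin.all? λ w → (w ∈? X) →-dec (¬? (w Fin.≟ u) →-dec dec u w)

  PairwiseAdjacent : Subset n → Set
  PairwiseAdjacent X = ∀ u v → u ∈ X → v ∈ X → u ≢ v → E u v

  greedy : List (Fin n) → Subset n → Subset n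
  greedy []       X = X
  greedy (u ∷ us) X with adjacentToAll? u X
  ... | yes _ = greedy us (X ∪ ⁅ u ⁆)
  ... | no  _ = greedy us X

  ⊆-greedy : ∀ us X → X ⊆ greedy us X
  ⊆-greedy []       X = λ x∈ → x∈
  ⊆-greedy (u ∷ us) X with adjacentToAll? u X
  ... | yes _ = ⊆-greedy us (X ∪ ⁅ u ⁆) ∘ p⊆p∪q ⁅ u ⁆
  ... | no  _ = ⊆-greedy us X

  PairwiseAdjacent-∪⁅⁆ : ∀ {u X} → PairwiseAdjacent X → AdjacentToAll u X → PairwiseAdjacent (X ∪ ⁅ u ⁆)
  PairwiseAdjacent-∪⁅⁆ {u} {X} pw adj a b a∈ b∈ a≢b with x∈p∪q⁻ X ⁅ u ⁆ a∈ | x∈p∪q⁻ X ⁅ u ⁆ b∈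
  ... | inj₁ a∈X | inj₁ b∈X = pw a b a∈X b∈X a≢b
  ... | inj₁ a∈X | inj₂ b∈u rewrite x∈⁅y⁆⇒x≡y u b∈u = E-sym (adj a a∈X a≢b)
  ... | inj₂ a∈u | inj₁ b∈X rewrite x∈⁅y⁆⇒x≡y u a∈u = adj b b∈X (a≢b ∘ sym)
  ... | inj₂ a∈u | inj₂ b∈u = contradiction (trans (x∈⁅y⁆⇒x≡y u a∈u) (sym (x∈⁅y⁆⇒x≡y u b∈u))) a≢b

  greedy-PairwiseAdjacent : ∀ us X → PairwiseAdjacent X → PairwiseAdjacent (greedy us X)
  greedy-PairwiseAdjacent []       X pw = pw
  greedy-PairwiseAdjacent (u ∷ us) X pw with adjacentToAll? u X
  ... | yes adj = greedy-PairwiseAdjacent us (X ∪ ⁅ u ⁆) (PairwiseAdjacent-∪⁅⁆ pw adj)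
  ... | no  _   = greedy-PairwiseAdjacent us X pw

  -- A rejected vertex stays rejected: adjacency to all of a set passes to its subsets.
  greedy-saturated : ∀ us X {u} → u ∈ₗ us → u ∈ greedy us X ⊎ ¬ AdjacentToAll u (greedy us X)
  greedy-saturated (u ∷ us) X (List.here refl) with adjacentToAll? u X
  ... | yes _   = inj₁ (⊆-greedy us (X ∪ ⁅ u ⁆) (q⊆p∪q X ⁅ u ⁆ (x∈⁅x⁆ u)))
  ... | no ¬adj = inj₂ λ adj → ¬adj λ w w∈ → adj w (⊆-greedy us X w∈)
  greedy-saturated (u′ ∷ us) X (List.there u∈) with adjacentToAll? u′ X
  ... | yes _ = greedy-saturated us (X ∪ ⁅ u′ ⁆) u∈
  ... | no  _ = greedy-saturated us X u∈

  ⊆-maximalClique : ∀ D → IsClique G D → ∃[ K ] (IsMaximalClique G K × D ⊆ K)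
  ⊆-maximalClique D ((v , v∈D) , pw) =
    K , ((K-nonempty , greedy-PairwiseAdjacent (allFin n) D pw) , maximal) , D⊆K
    where
    K : Subset n
    K = greedy (allFin n) D
    D⊆K : D ⊆ K
    D⊆K = ⊆-greedy (allFin n) D
    K-nonempty : Nonempty K
    K-nonempty = v , D⊆K v∈D
    maximal : ∀ D′ → IsClique G D′ → K ⊆ D′ → D′ ⊆ K
    maximal D′ (_ , pw′) K⊆D′ {u} u∈D′ with greedy-saturated (allFin n) D (∈-allFin u)
    ... | inj₁ u∈K = u∈K
    ... | inj₂ ¬adj = contradiction (λ w w∈K w≢u → pw′ u w u∈D′ (K⊆D′ w∈K) (w≢u ∘ sym)) ¬adj

module _ (G : Graph) (ME : MaxCliqueEnum G) where
  open Graph G using (n)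
  open MaxCliqueEnum ME

  ∈cliquesV⇔∈Cl : ∀ {v i} → i ∈ cliquesV G ME v ⇔ v ∈ Cl i
  ∈cliquesV⇔∈Cl {v} = x∈tabulate⇔ (λ i → v ∈? Cl i)

  ∈cliques⇔⊆Cl : ∀ {k C} → _∈cliques_ G ME k C ⇔ C ⊆ Cl k
  ∈cliques⇔⊆Cl = mk⇔ (λ k∈ {v} v∈ → Equivalence.to ∈cliquesV⇔∈Cl (k∈ v v∈))
                     (λ C⊆ v v∈ → Equivalence.from ∈cliquesV⇔∈Cl (C⊆ v∈))

  ⊆Cl⇒IsClique : ∀ {k D} → D ⊆ Cl k → Nonempty D → IsClique G D
  ⊆Cl⇒IsClique {k} D⊆ ne = ne , λ u v u∈ v∈ → proj₂ (proj₁ (maxCl k)) u v (D⊆ u∈) (D⊆ v∈)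

  IsClique⇒⊆Cl : ∀ {D} → IsClique G D → ∃[ k ] D ⊆ Cl k
  IsClique⇒⊆Cl {D} D-clique with ⊆-maximalClique G D D-clique
  ... | K , K-max , D⊆K with complete K K-max
  ...   | k , refl = k , D⊆K

  ⁅⁆-IsClique : ∀ v → IsClique G ⁅ v ⁆
  ⁅⁆-IsClique v = (v , x∈⁅x⁆ v) , λ a b a∈ b∈ a≢b →
    contradiction (trans (x∈⁅y⁆⇒x≡y v a∈) (sym (x∈⁅y⁆⇒x≡y v b∈))) a≢b

  ∃Cl∋ : ∀ v → ∃[ i ] v ∈ Cl i
  ∃Cl∋ v with IsClique⇒⊆Cl (⁅⁆-IsClique v)
  ... | i , ⁅v⁆⊆ = i , ⁅v⁆⊆ (x∈⁅x⁆ v)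

  d≤1⇒Cl-unique : ∀ {v i j} → d G ME v ≤ 1 → v ∈ Cl i → v ∈ Cl j → i ≡ j
  d≤1⇒Cl-unique d≤1 v∈i v∈j =
    ∣p∣≤1⇒x≡y d≤1 (Equivalence.from ∈cliquesV⇔∈Cl v∈i) (Equivalence.from ∈cliquesV⇔∈Cl v∈j)

  cliquesV≡⁅⁆⇒Cl-unique : ∀ w {i j} → cliquesV G ME w ≡ ⁅ i ⁆ → w ∈ Cl j → j ≡ i
  cliquesV≡⁅⁆⇒Cl-unique w {i} {j} eq w∈ =
    x∈⁅y⁆⇒x≡y i (subst (j ∈_) eq (Equivalence.from ∈cliquesV⇔∈Cl w∈))

  d≤1⇒cliquesV≡⁅⁆ : ∀ {v i} → d G ME v ≤ 1 → v ∈ Cl i → cliquesV G ME v ≡ ⁅ i ⁆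
  d≤1⇒cliquesV≡⁅⁆ {v} {i} d≤1 v∈ = ⊆-antisym
    (λ {j} j∈ → subst (_∈ ⁅ i ⁆) (sym (d≤1⇒Cl-unique d≤1 (Equivalence.to ∈cliquesV⇔∈Cl j∈) v∈)) (x∈⁅x⁆ i))
    (λ {j} j∈ → subst (_∈ cliquesV G ME v) (sym (x∈⁅y⁆⇒x≡y i j∈)) (Equivalence.from ∈cliquesV⇔∈Cl v∈))

  lookup-root : ∀ i → lookup (root G ME) i ≡ Cl i
  lookup-root = lookup∘tabulate Cl

  module Moved {c c′ : Config G ME} {x i} (mv : Move G ME c x i c′) where
    private
      x∈cᵢ : x ∈ lookup c i
      x∈cᵢ = proj₁ mv
      c′ᵢ≡cᵢ : lookup c′ i ≡ lookup c i
      c′ᵢ≡cᵢ = proj₁ (proj₂ mv)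
      c′ⱼ≡cⱼ-x : ∀ j → j ≢ i → lookup c′ j ≡ lookup c j - x
      c′ⱼ≡cⱼ-x = proj₂ (proj₂ mv)

    Move-⊆ : ∀ j → lookup c′ j ⊆ lookup c j
    Move-⊆ j v∈ with j Fin.≟ i
    ... | yes refl = subst (_ ∈_) c′ᵢ≡cᵢ v∈
    ... | no j≢i = x∈p-y⇒x∈p (lookup c j) (subst (_ ∈_) (c′ⱼ≡cⱼ-x j j≢i) v∈)

    Move-keeps : ∀ j {v} → v ∈ lookup c j → v ≢ x → v ∈ lookup c′ j
    Move-keeps j v∈ v≢x with j Fin.≟ i
    ... | yes refl = subst (_ ∈_) (sym c′ᵢ≡cᵢ) v∈
    ... | no j≢i = subst (_ ∈_) (sym (c′ⱼ≡cⱼ-x j j≢i)) (x∈p∧x≢y⇒x∈p-y v∈ v≢x)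

    Move-places : x ∈ lookup c′ i
    Move-places = subst (_ ∈_) (sym c′ᵢ≡cᵢ) x∈cᵢ

    Move-unique : ∀ {j} → x ∈ lookup c′ j → j ≡ i
    Move-unique {j} x∈ with j Fin.≟ i
    ... | yes j≡i = j≡i
    ... | no j≢i = contradiction refl (x∈p-y⇒x≢y (lookup c j) (subst (_ ∈_) (c′ⱼ≡cⱼ-x j j≢i) x∈))

  move : Config G ME → Fin n → Fin m → Config G ME
  move c x i = map (_- x) c [ i ]≔ lookup c i

  move-Move : ∀ {c x i} → x ∈ lookup c i → Move G ME c x i (move c x i)
  move-Move {c} {x} {i} x∈ = x∈ , lookup∘update i (map (_- x) c) (lookup c i) , λ j j≢i →
    trans (lookup∘update′ j≢i (map (_- x) c) (lookup c i)) (lookup-map j (_- x) c)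

  record Canonical (c : Config G ME) : Set where
    field
      ⊆Cl         : ∀ i → lookup c i ⊆ Cl i
      cover       : ∀ v → ∃[ i ] v ∈ lookup c i
      unique      : ∀ {v i j} → v ∈ lookup c i → v ∈ lookup c j → i ≡ j
      unmergeable : ∀ {i j k} → i ≢ j → Nonempty (lookup c i) → Nonempty (lookup c j) →
                    lookup c i ⊆ Cl k → lookup c j ⊆ Cl k → ⊥
      ordered     : ∀ {j i} → j Fin.< i → Nonempty (lookup c j) → ¬ lookup c j ⊆ Cl i

  Canonical⇒Π! : ∀ {c} → Canonical c → Π! G ME c
  Canonical⇒Π! {c} can =
    ((empty-or-clique , ⊆Cl , cover) , (member-clique , disjoint , covered) , maximal) , ordered′
    where
    open Canonical can
    empty-or-clique : ∀ i → Empty (lookup c i) ⊎ IsClique G (lookup c i)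
    empty-or-clique i with nonempty? (lookup c i)
    ... | yes ne = inj₂ (⊆Cl⇒IsClique (⊆Cl i) ne)
    ... | no ¬ne = inj₁ ¬ne
    member-clique : ∀ C → repr G ME c C → IsClique G C
    member-clique _ (i , refl , ne) = ⊆Cl⇒IsClique (⊆Cl i) ne
    disjoint : ∀ C C′ → repr G ME c C → repr G ME c C′ → C ≢ C′ → Empty (C ∩ C′)
    disjoint _ _ (i , refl , _) (j , refl , _) C≢C′ (v , v∈) with x∈p∩q⁻ _ _ v∈
    ... | v∈i , v∈j = C≢C′ (cong (lookup c) (unique v∈i v∈j))
    covered : ∀ v → ∃[ C ] (repr G ME c C × v ∈ C)
    covered v with cover v
    ... | i , v∈ = lookup c i , (i , refl , (v , v∈)) , v∈
    maximal : ∀ C C′ → repr G ME c C → repr G ME c C′ → C ≢ C′ → ¬ IsClique G (C ∪ C′)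
    maximal _ _ (i , refl , neᵢ) (j , refl , neⱼ) C≢C′ ∪-clique with IsClique⇒⊆Cl ∪-clique
    ... | k , ∪⊆ = unmergeable (C≢C′ ∘ cong (lookup c)) neᵢ neⱼ (∪⊆ ∘ p⊆p∪q _) (∪⊆ ∘ q⊆p∪q _ _)
    ordered′ : ∀ j i → j Fin.< i → Nonempty (lookup c j) → ¬ _∈cliques_ G ME i (lookup c j)
    ordered′ j i j<i ne = ordered j<i ne ∘ Equivalence.to ∈cliques⇔⊆Cl

  Π!⇒Canonical : ∀ {c} → Π! G ME c → Canonical c
  Π!⇒Canonical {c} (((_ , ⊆Cl , cover) , (_ , disjoint , _) , maximal) , ordered′) = record
    { ⊆Cl = ⊆Cl ; cover = cover ; unique = unique ; unmergeable = unmergeable ; ordered = ordered }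
    where
    ordered : ∀ {j i} → j Fin.< i → Nonempty (lookup c j) → ¬ lookup c j ⊆ Cl i
    ordered {j} {i} j<i ne = ordered′ j i j<i ne ∘ Equivalence.from ∈cliques⇔⊆Cl
    -- repr only sees the set of cells, so it is the ordering that keeps two indices from sharing a cell.
    distinct-cells : ∀ {i j} → i ≢ j → Nonempty (lookup c i) → lookup c i ≢ lookup c j
    distinct-cells {i} {j} i≢j ne eq with Fin.<-cmp i j
    ... | tri< i<j _ _ = ordered i<j ne (subst (_⊆ Cl j) (sym eq) (⊆Cl j))
    ... | tri≈ _ i≡j _ = i≢j i≡j
    ... | tri> _ _ j<i = ordered j<i (subst Nonempty eq ne) (subst (_⊆ Cl i) eq (⊆Cl i))
    unique : ∀ {v i j} → v ∈ lookup c i → v ∈ lookup c j → i ≡ j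
    unique {v} {i} {j} v∈i v∈j with i Fin.≟ j
    ... | yes i≡j = i≡j
    ... | no i≢j = contradiction (v , x∈p∩q⁺ (v∈i , v∈j))
        (disjoint _ _ (i , refl , (v , v∈i)) (j , refl , (v , v∈j)) (distinct-cells i≢j (v , v∈i)))
    unmergeable : ∀ {i j k} → i ≢ j → Nonempty (lookup c i) → Nonempty (lookup c j) →
                  lookup c i ⊆ Cl k → lookup c j ⊆ Cl k → ⊥
    unmergeable i≢j neᵢ@(v , v∈) neⱼ i⊆k j⊆k =
      maximal _ _ (_ , refl , neᵢ) (_ , refl , neⱼ) (distinct-cells i≢j neᵢ)
        (⊆Cl⇒IsClique (∪-least i⊆k j⊆k) (v , p⊆p∪q _ v∈))

  rigid∈ : ∀ {c} w {i} → (∀ j → lookup c j ⊆ Cl j) → (∀ v → ∃[ j ] v ∈ lookup c j) →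
           cliquesV G ME w ≡ ⁅ i ⁆ → w ∈ lookup c i
  rigid∈ w ⊆Cl cover eq with cover w
  ... | j , w∈ with refl ← cliquesV≡⁅⁆⇒Cl-unique w eq (⊆Cl j w∈) = w∈

  module _ {c c′ : Config G ME} (c⊆c′ : ∀ i → lookup c i ⊆ lookup c′ i) {δ : List (Fin m)} where
    private
      shrink : ∀ {k} a → _∈cliques_ G ME k (lookup c′ a) → _∈cliques_ G ME k (lookup c a)
      shrink a k∈ v v∈ = k∈ v (c⊆c′ a v∈)

    T1-antitone : T1 G ME δ c′ → T1 G ME δ c
    T1-antitone (inj₁ (a , a∈δ , ¬rgd , k , k∈ , rgd)) = inj₁ (a , a∈δ , ¬rgd , k , shrink a k∈ , rgd)
    T1-antitone (inj₂ (a , b , a∈δ , b∈δ , a≢b , k , k∈a , k∈b)) =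
      inj₂ (a , b , a∈δ , b∈δ , a≢b , k , shrink a k∈a , shrink b k∈b)

    T2-antitone : T2 G ME δ c′ → T2 G ME δ c
    T2-antitone (j , i , j<i , j∈δ , ¬rgd , i∈) = j , i , j<i , j∈δ , ¬rgd , shrink j i∈

  module _ {c} (can : Canonical c) {δ : List (Fin m)}
           (δ-nonempty : ∀ {a} → a ∈ₗ δ → Nonempty (lookup c a)) where
    open Canonical can
    private
      ⊆Cl-of : ∀ {k C} → _∈cliques_ G ME k C → C ⊆ Cl k
      ⊆Cl-of = Equivalence.to ∈cliques⇔⊆Cl

    Canonical⇒¬T1 : ¬ T1 G ME δ c
    Canonical⇒¬T1 (inj₁ (a , a∈δ , ¬rgd , k , k∈a , w , rw)) =
      unmergeable (λ { refl → ¬rgd (w , rw) }) (δ-nonempty a∈δ) (w , rigid∈ {c} w ⊆Cl cover rw)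
        (⊆Cl-of k∈a) (⊆Cl k)
    Canonical⇒¬T1 (inj₂ (a , b , a∈δ , b∈δ , a≢b , k , k∈a , k∈b)) =
      unmergeable a≢b (δ-nonempty a∈δ) (δ-nonempty b∈δ) (⊆Cl-of k∈a) (⊆Cl-of k∈b)

    Canonical⇒¬T2 : ¬ T2 G ME δ c
    Canonical⇒¬T2 (j , i , j<i , j∈δ , _ , i∈j) = ordered j<i (δ-nonempty j∈δ) (⊆Cl-of i∈j)

  module _ (SE : MultiEnum G ME) where
    open MultiEnum SE renaming (complete to listed)

    nextVertex : ∀ {k} → k < s → Fin n
    nextVertex k<s = vs (fromℕ< k<s)

    Processed : ℕ → Fin n → Set
    Processed k v = ∃[ l ] (toℕ l < k × vs l ≡ v)

    Processed-suc⁺ : ∀ {k v} → Processed k v → Processed (suc k) v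
    Processed-suc⁺ (l , l<k , eq) = l , ℕ.m<n⇒m<1+n l<k , eq

    Processed-next : ∀ {k} (k<s : k < s) → Processed (suc k) (nextVertex k<s)
    Processed-next k<s = fromℕ< k<s , s≤s (ℕ.≤-reflexive (Fin.toℕ-fromℕ< k<s)) , refl

    ¬Processed-next : ∀ {k} (k<s : k < s) → ¬ Processed k (nextVertex k<s)
    ¬Processed-next k<s (l , l<k , eq) = ℕ.<-irrefl (trans (cong toℕ (injvs eq)) (Fin.toℕ-fromℕ< k<s)) l<k

    Processed-suc⁻ : ∀ {k v} (k<s : k < s) → Processed (suc k) v → Processed k v ⊎ v ≡ nextVertex k<s
    Processed-suc⁻ k<s (l , l<1+k , refl) with ℕ.m<1+n⇒m<n∨m≡n l<1+k
    ... | inj₁ l<k = inj₁ (l , l<k , refl)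
    ... | inj₂ l≡k = inj₂ (cong vs (Fin.toℕ-injective (trans l≡k (sym (Fin.toℕ-fromℕ< k<s)))))

    d≤1⇒¬Processed : ∀ {k v} → d G ME v ≤ 1 → ¬ Processed k v
    d≤1⇒¬Processed d≤1 (l , _ , refl) = ℕ.<⇒≱ (multi l) d≤1

    Processed-s⊎d≤1 : ∀ v → Processed s v ⊎ d G ME v ≤ 1
    Processed-s⊎d≤1 v with 1 ℕ.<? d G ME v
    ... | yes 1<d = let l , vₗ≡v = listed v 1<d in inj₁ (l , Fin.toℕ<n l , vₗ≡v)
    ... | no 1≮d = inj₂ (ℕ.≮⇒≥ 1≮d)

    Node⇒¬Prune : ∀ {Prune k δ c} → Node G ME SE Prune k δ c → ¬ Prune δ c
    Node⇒¬Prune (nroot ¬prune) = ¬prune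
    Node⇒¬Prune (nchild _ _ _ _ _ ¬prune) = ¬prune

    record Invariant (k : ℕ) (δ : List (Fin m)) (c : Config G ME) : Set where
      field
        ⊆Cl          : ∀ i → lookup c i ⊆ Cl i
        unprocessed∈ : ∀ {i v} → v ∈ Cl i → ¬ Processed k v → v ∈ lookup c i
        processed∈   : ∀ {v} → Processed k v →
                       ∃[ i ] (i ∈ₗ δ × v ∈ lookup c i × (∀ {j} → v ∈ lookup c j → j ≡ i))

    invariant : ∀ {Prune k δ c} → Node G ME SE Prune k δ c → Invariant k δ c
    invariant (nroot _) = record
      { ⊆Cl          = λ i → subst (_ ∈_) (lookup-root i)
      ; unprocessed∈ = λ {i} v∈ _ → subst (_ ∈_) (sym (lookup-root i)) v∈
      ; processed∈   = λ { (_ , () , _) }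
      }
    invariant (nchild {k} {δ} {c} {c′} k<s i node _ mv _) = record
      { ⊆Cl          = λ j → ⊆Cl j ∘ Move-⊆ j
      ; unprocessed∈ = λ v∈ ¬p →
          Move-keeps _ (unprocessed∈ v∈ (¬p ∘ Processed-suc⁺)) λ { refl → ¬p (Processed-next k<s) }
      ; processed∈   = processed∈′
      }
      where
      open Invariant (invariant node)
      open Moved {c} {c′} mv
      processed∈′ : ∀ {v} → Processed (suc k) v →
                    ∃[ a ] (a ∈ₗ δ ++ [ i ] × v ∈ lookup c′ a × (∀ {j} → v ∈ lookup c′ j → j ≡ a))
      processed∈′ p with Processed-suc⁻ k<s p
      ... | inj₂ refl = i , ∈-++⁺ʳ δ (List.here refl) , Move-places , Move-unique
      ... | inj₁ p-old with processed∈ p-old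
      ...   | a , a∈δ , v∈ , only-a =
              a , ∈-++⁺ˡ a∈δ , Move-keeps a v∈ (λ { refl → ¬Processed-next k<s p-old }) ,
              only-a ∘ Move-⊆ _

    module LeafAnalysis {δ c} (node : Node G ME SE (T1orT2 G ME SE) s δ c) where
      open Invariant (invariant node)

      ¬pruned : ¬ T1orT2 G ME SE δ c
      ¬pruned = Node⇒¬Prune node

      unique : ∀ {v a b} → v ∈ lookup c a → v ∈ lookup c b → a ≡ b
      unique {v} v∈a v∈b with Processed-s⊎d≤1 v
      ... | inj₁ p = let _ , _ , _ , only = processed∈ p in trans (only v∈a) (sym (only v∈b))
      ... | inj₂ d≤1 = d≤1⇒Cl-unique d≤1 (⊆Cl _ v∈a) (⊆Cl _ v∈b)

      cover : ∀ v → ∃[ i ] v ∈ lookup c i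
      cover v with Processed-s⊎d≤1 v
      ... | inj₁ p = let i , _ , v∈ , _ = processed∈ p in i , v∈
      ... | inj₂ d≤1 = let i , v∈ = ∃Cl∋ v in i , unprocessed∈ v∈ (d≤1⇒¬Processed d≤1)

      chosen-or-rigid : ∀ {a} → Nonempty (lookup c a) →
                        a ∈ₗ δ ⊎ ∃[ w ] (w ∈ lookup c a × cliquesV G ME w ≡ ⁅ a ⁆)
      chosen-or-rigid (u , u∈) with Processed-s⊎d≤1 u
      ... | inj₁ p = let _ , i∈δ , _ , only = processed∈ p in inj₁ (subst (_∈ₗ δ) (sym (only u∈)) i∈δ)
      ... | inj₂ d≤1 = inj₂ (u , u∈ , d≤1⇒cliquesV≡⁅⁆ d≤1 (⊆Cl _ u∈))

      ⊆Cl-other⇒¬Rgd : ∀ {a b} → a ≢ b → lookup c b ⊆ Cl a → ¬ Rgd G ME b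
      ⊆Cl-other⇒¬Rgd a≢b b⊆a (w , rw) = a≢b (cliquesV≡⁅⁆⇒Cl-unique w rw (b⊆a (rigid∈ {c} w ⊆Cl cover rw)))

      rigid-unmergeable : ∀ {a b} w → a ≢ b → cliquesV G ME w ≡ ⁅ a ⁆ →
                          Nonempty (lookup c b) → lookup c b ⊆ Cl a → ⊥
      rigid-unmergeable w a≢b rw neb b⊆a with chosen-or-rigid neb
      ... | inj₁ b∈δ = ¬pruned (inj₁ (inj₁
              (_ , b∈δ , ⊆Cl-other⇒¬Rgd a≢b b⊆a , _ , Equivalence.from ∈cliques⇔⊆Cl b⊆a , w , rw)))
      ... | inj₂ (w′ , w′∈ , rw′) = a≢b (cliquesV≡⁅⁆⇒Cl-unique w′ rw′ (b⊆a w′∈))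

      unmergeable : ∀ {a b k} → a ≢ b → Nonempty (lookup c a) → Nonempty (lookup c b) →
                    lookup c a ⊆ Cl k → lookup c b ⊆ Cl k → ⊥
      unmergeable a≢b nea neb a⊆k b⊆k with chosen-or-rigid nea | chosen-or-rigid neb
      ... | inj₂ (w , w∈ , rw) | _ with refl ← cliquesV≡⁅⁆⇒Cl-unique w rw (a⊆k w∈) =
              rigid-unmergeable w a≢b rw neb b⊆k
      ... | inj₁ _ | inj₂ (w , w∈ , rw) with refl ← cliquesV≡⁅⁆⇒Cl-unique w rw (b⊆k w∈) =
              rigid-unmergeable w (a≢b ∘ sym) rw nea a⊆k
      ... | inj₁ a∈δ | inj₁ b∈δ = ¬pruned (inj₁ (inj₂
              (_ , _ , a∈δ , b∈δ , a≢b , _ ,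
               Equivalence.from ∈cliques⇔⊆Cl a⊆k , Equivalence.from ∈cliques⇔⊆Cl b⊆k)))

      ordered : ∀ {j i} → j Fin.< i → Nonempty (lookup c j) → ¬ lookup c j ⊆ Cl i
      ordered j<i nej j⊆i with chosen-or-rigid nej
      ... | inj₁ j∈δ = ¬pruned (inj₂
              (_ , _ , j<i , j∈δ , ⊆Cl-other⇒¬Rgd (Fin.<⇒≢ j<i ∘ sym) j⊆i ,
               Equivalence.from ∈cliques⇔⊆Cl j⊆i))
      ... | inj₂ (w , w∈ , rw) = Fin.<⇒≢ j<i (sym (cliquesV≡⁅⁆⇒Cl-unique w rw (j⊆i w∈)))

      canonical : Canonical c
      canonical = record
        { ⊆Cl = ⊆Cl ; cover = cover ; unique = unique ; unmergeable = unmergeable ; ordered = ordered }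

    Leaf⇒Canonical : ∀ {c} → Leaf G ME SE c → Canonical c
    Leaf⇒Canonical (_ , node) = LeafAnalysis.canonical node

    module PathTo {c} (can : Canonical c) where
      open Canonical can

      record Approximates (k : ℕ) (δ : List (Fin m)) (c′ : Config G ME) : Set where
        field
          ∈⇔         : ∀ {i v} → v ∈ lookup c′ i ⇔ (v ∈ Cl i × (Processed k v → v ∈ lookup c i))
          δ-nonempty : ∀ {a} → a ∈ₗ δ → Nonempty (lookup c a)

      module _ {k δ c′} (approx : Approximates k δ c′) where
        open Approximates approx

        Approximates-⊇ : ∀ i → lookup c i ⊆ lookup c′ i
        Approximates-⊇ i v∈ = Equivalence.from ∈⇔ (⊆Cl i v∈ , λ _ → v∈)

        Approximates⇒¬T1orT2 : ¬ T1orT2 G ME SE δ c′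
        Approximates⇒¬T1orT2 =
          [ Canonical⇒¬T1 can δ-nonempty ∘ T1-antitone {c} {c′} Approximates-⊇
          , Canonical⇒¬T2 can δ-nonempty ∘ T2-antitone {c} {c′} Approximates-⊇ ]′

      Approximates⇒≡ : ∀ {δ c′} → Approximates s δ c′ → c′ ≡ c
      Approximates⇒≡ {c′ = c′} approx = lookup-ext λ i → ⊆-antisym (c′ᵢ⊆cᵢ i) (Approximates-⊇ approx i)
        where
        open Approximates approx
        c′ᵢ⊆cᵢ : ∀ i → lookup c′ i ⊆ lookup c i
        c′ᵢ⊆cᵢ i {v} v∈ with Equivalence.to ∈⇔ v∈ | Processed-s⊎d≤1 v
        ... | _ , v∈cᵢ | inj₁ p = v∈cᵢ p
        ... | v∈Clᵢ , _ | inj₂ d≤1 with cover v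
        ...   | j , v∈cⱼ with refl ← d≤1⇒Cl-unique d≤1 (⊆Cl j v∈cⱼ) v∈Clᵢ = v∈cⱼ

      approximates-root : Approximates 0 [] (root G ME)
      approximates-root = record
        { ∈⇔ = λ {i} → mk⇔ (λ v∈ → subst (_ ∈_) (lookup-root i) v∈ , λ { (_ , () , _) })
                           (λ (v∈ , _) → subst (_ ∈_) (sym (lookup-root i)) v∈)
        ; δ-nonempty = λ ()
        }

      approximates-move : ∀ {k δ c′ a} (k<s : k < s) → nextVertex k<s ∈ lookup c a → Approximates k δ c′ →
                          Approximates (suc k) (δ ++ [ a ]) (move c′ (nextVertex k<s) a)
      approximates-move {k} {δ} {c′} {a} k<s v∈a approx =
        record { ∈⇔ = mk⇔ forward backward ; δ-nonempty = δ′-nonempty }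
        where
        open Approximates approx
        v : Fin n
        v = nextVertex k<s
        open Moved {c′} {move c′ v a} (move-Move {c′} (Approximates-⊇ approx a v∈a))
        forward : ∀ {i u} → u ∈ lookup (move c′ v a) i → u ∈ Cl i × (Processed (suc k) u → u ∈ lookup c i)
        forward {i} u∈ with Equivalence.to ∈⇔ (Move-⊆ i u∈)
        ... | u∈Clᵢ , processed⇒u∈cᵢ = u∈Clᵢ ,
              [ processed⇒u∈cᵢ , (λ { refl → subst (λ j → v ∈ lookup c j) (sym (Move-unique u∈)) v∈a }) ]′
              ∘ Processed-suc⁻ k<s
        backward : ∀ {i u} → u ∈ Cl i × (Processed (suc k) u → u ∈ lookup c i) → u ∈ lookup (move c′ v a) i
        backward {i} {u} (u∈Clᵢ , processed⇒u∈cᵢ) with u Fin.≟ v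
        ... | yes refl with refl ← unique (processed⇒u∈cᵢ (Processed-next k<s)) v∈a = Move-places
        ... | no u≢v = Move-keeps i (Equivalence.from ∈⇔ (u∈Clᵢ , processed⇒u∈cᵢ ∘ Processed-suc⁺)) u≢v
        δ′-nonempty : ∀ {b} → b ∈ₗ δ ++ [ a ] → Nonempty (lookup c b)
        δ′-nonempty b∈ with ∈-++⁻ δ b∈
        ... | inj₁ b∈δ = δ-nonempty b∈δ
        ... | inj₂ (List.here refl) = v , v∈a

      path : ∀ k → k ≤ s → ∃[ δ ] ∃[ c′ ] (Node G ME SE (T1orT2 G ME SE) k δ c′ × Approximates k δ c′)
      path zero _ = [] , root G ME , nroot (Approximates⇒¬T1orT2 approximates-root) , approximates-root
      path (suc k) k<s with path k (ℕ.<⇒≤ k<s)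
      ... | δ , c′ , node , approx = _ , _ , node′ , approx′
        where
        v : Fin n
        v = nextVertex k<s
        a : Fin m
        a = proj₁ (cover v)
        v∈a : v ∈ lookup c a
        v∈a = proj₂ (cover v)
        approx′ : Approximates (suc k) (δ ++ [ a ]) (move c′ v a)
        approx′ = approximates-move k<s v∈a approx
        node′ : Node G ME SE (T1orT2 G ME SE) (suc k) (δ ++ [ a ]) (move c′ v a)
        node′ = nchild k<s a node (Equivalence.from ∈cliquesV⇔∈Cl (⊆Cl a v∈a))
                  (move-Move {c′} (Approximates-⊇ approx a v∈a)) (Approximates⇒¬T1orT2 approx′)

    Canonical⇒Leaf : ∀ {c} → Canonical c → Leaf G ME SE c
    Canonical⇒Leaf can with PathTo.path can s ℕ.≤-refl
    ... | δ , _ , node , approx =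
      δ , subst (Node G ME SE (T1orT2 G ME SE) s δ) (PathTo.Approximates⇒≡ can approx) node

lemma6 : (G : Graph) (ME : MaxCliqueEnum G) (SE : MultiEnum G ME)
         (cfg : Config G ME) →
         Leaf G ME SE cfg ⇔ Π! G ME cfg
lemma6 G ME SE cfg = mk⇔
  (Canonical⇒Π! G ME ∘ Leaf⇒Canonical G ME SE)
  (Canonical⇒Leaf G ME SE ∘ Π!⇒Canonical G ME)
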